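{- Let $d\ge 2$, $t\ge 1$ and $n\ge 1$ be integers with $n\le 2t-2$. Then the directed de Bruijn graph $\vec{\mathcal B}(d,n)$ has no $t$-identifying code.
   Context: $\mathcal A_d=\{0,1,\dots,d-1\}$. The directed de Bruijn graph $\vec{\mathcal B}(d,n)$ has vertex set $\mathcal A_d^n$ (strings of length $n$ over $\mathcal A_d$) and an arc from $x_1\cdots x_n$ to $y_1\cdots y_n$ iff $x_2\cdots x_n=y_1\cdots y_{n-1}$. $\vec d(u,v)$ is the length of a shortest directed walk from $u$ to $v$; $B_t^-(v)=\{u:\vec d(u,v)\le t\}$; for $S\subseteq V$, $\mathrm{ID}_S(v)=B_t^-(v)\cap S$; a $t$-identifying code is a set $S$ with $\mathrm{ID}_S(v)\ne\emptyset$ for all $v$ and $\mathrm{ID}_S(u)\ne\mathrm{ID}_S(v)$ for all $u\ne v$. -}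

module Defs where

open import Data.Nat using (ℕ; zero; suc; _≤_)
open import Data.Fin using (Fin)
open import Data.Vec using (Vec; _∷_; []; tail; init; _∷ʳ_)
open import Data.Bool using (Bool; true)
open import Data.Product using (Σ; _×_; ∃-syntax)
open import Relation.Binary.PropositionalEquality using (_≡_)
open import Relation.Nullary using (¬_)
open import Function.Bundles using (_⇔_)

Vertex : ℕ → ℕ → Set
Vertex d n = Vec (Fin d) n

-- Arc x → y iff x₂⋯xₙ = y₁⋯y_{n-1}, i.e. y = x₂⋯xₙ a for some letter a.
-- (For n ≥ 1 this is equivalent to tail x ≡ init y; stated via the shift.)
Arc : ∀ {d n} → Vertex d (suc n) → Vertex d (suc n) → Set
Arc {d} x y = ∃[ a ] (y ≡ tail x ∷ʳ a)

data Walk {d n : ℕ} : Vertex d (suc n) → Vertex d (suc n) → ℕ → Set where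
  stay : ∀ {u} → Walk u u zero
  step : ∀ {u v w k} → Arc u v → Walk v w k → Walk u w (suc k)

-- u ∈ B_t^-(v)  iff  d(u,v) ≤ t  iff  some walk from u to v has length ≤ t.
InBall : ∀ {d n} → ℕ → Vertex d (suc n) → Vertex d (suc n) → Set
InBall t v u = ∃[ k ] (k ≤ t × Walk u v k)

-- A set S of vertices (a finite subset, given by its characteristic function).
-- w ∈ ID_S(v)  iff  w ∈ S and w ∈ B_t^-(v).
InID : ∀ {d n} → ℕ → (Vertex d (suc n) → Bool) → Vertex d (suc n) → Vertex d (suc n) → Set
InID t S v w = (S w ≡ true) × InBall t v w

IsIdentifyingCode : ∀ {d n} → ℕ → (Vertex d (suc n) → Bool) → Set
IsIdentifyingCode {d} {n} t S =
  (∀ (v : Vertex d (suc n)) → ∃[ w ] InID t S v w)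
  × (∀ (u v : Vertex d (suc n)) → ¬ (u ≡ v) → ¬ (∀ w → InID t S u w ⇔ InID t S v w))

module Submission where

-- Call two vertices x = p·a and y = p·b (a ≠ b) of B(d,N)
-- twins: they differ only in their last letter, so they have exactly the
-- same in-neighbours, and any walk of positive length into x can be
-- redirected into y by changing the letter appended in its last arc.
-- Hence if x ∈ B_t⁻(y), the whole ball B_t⁻(x) lies in B_t⁻(y); if the
-- twins are mutually within distance t, their balls coincide and no set S
-- can separate them, so there is no t-identifying code.
--
-- Walks are produced by word overlaps: if u = pre·m and v = m·L, then
-- appending the letters of L one by one is a walk u → v of length |L|.
-- For N = 1 the twins 0 and 1 are at distance 1.  For N = n + 2 we write
-- n = a + (e + a) with e + a + 2 ≤ t (possible since N ≤ 2t - 2) and take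
--   x = 0^a 1 0^(e+a) 0,   y = 0^a 1 0^(e+a) 1,
-- with x → y of length e + a + 2 and y → x of length e + a + 1.

open import Defs
open import Data.Nat using (ℕ; zero; suc; _+_; _*_; _∸_; _≤_; z≤n; s≤s; s≤s⁻¹)
open import Data.Nat.Properties using (+-suc; +-comm; +-cancelˡ-≡; *-distribˡ-∸; n≤1+n; ≤-trans; suc-injective)
open import Data.Fin using (Fin)
open import Data.Fin.Patterns using (0F; 1F)
open import Data.Vec using (Vec; []; _∷_; _∷ʳ_; toList; fromList)
open import Data.Vec.Properties using (toList-injective; cast-is-id; toList-∷ʳ; toList∘fromList; length-toList; ∷ʳ-injectiveˡ; ∷ʳ-injectiveʳ)
open import Data.List using (List; length; replicate; _++_; [_])
  renaming ([] to []ₗ; _∷_ to _∷ₗ_)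
open import Data.List.Properties using (++-assoc; ++-identityʳ; length-++; length-replicate; ∷-injectiveʳ)
open import Data.Bool using (Bool)
open import Data.Product using (Σ; _×_; _,_; ∃₂; map₂)
open import Function using (_∘_)
open import Function.Bundles using (mk⇔)
open import Relation.Nullary using (¬_)
open import Relation.Binary.PropositionalEquality using (_≡_; _≢_; refl; sym; trans; cong; subst; module ≡-Reasoning)

open ≡-Reasoning

-- The target of a walk of positive length is fixed by its last arc only up
-- to the last letter: a walk into p·a can be turned into one into p·b.
redirect : ∀ {d n k} {u : Vertex d (suc n)} (p : Vec (Fin d) n) {a : Fin d} (b : Fin d) →
           Walk u (p ∷ʳ a) (suc k) → Walk u (p ∷ʳ b) (suc k)
redirect p b (step (c , p·a≡) stay) =
  step (b , cong (_∷ʳ b) (∷ʳ-injectiveˡ p _ p·a≡)) stay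
redirect p b (step arc walk@(step _ _)) = step arc (redirect p b walk)

twin-ball-⊆ : ∀ {d n t} (p : Vec (Fin d) n) {a b : Fin d} →
              InBall t (p ∷ʳ b) (p ∷ʳ a) →
              ∀ w → InBall t (p ∷ʳ a) w → InBall t (p ∷ʳ b) w
twin-ball-⊆ p x∈By w (zero , _ , stay) = x∈By
twin-ball-⊆ p {b = b} x∈By w (suc k , k≤t , walk) = suc k , k≤t , redirect p b walk

close-twins⇒no-code : ∀ {d n t} (p : Vec (Fin d) n) {a b : Fin d} → a ≢ b →
                      InBall t (p ∷ʳ b) (p ∷ʳ a) → InBall t (p ∷ʳ a) (p ∷ʳ b) →
                      (S : Vertex d (suc n) → Bool) → ¬ IsIdentifyingCode t S
close-twins⇒no-code p {a} {b} a≢b x∈By y∈Bx S (_ , separates) =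
  separates (p ∷ʳ a) (p ∷ʳ b) (a≢b ∘ ∷ʳ-injectiveʳ p p)
    (λ w → mk⇔ (map₂ (twin-ball-⊆ p x∈By w)) (map₂ (twin-ball-⊆ p y∈Bx w)))

shift-walk : ∀ {d n} (u v : Vertex d (suc n)) (pre m L : List (Fin d)) →
             toList u ≡ pre ++ m → toList v ≡ m ++ L → length pre ≡ length L →
             Walk u v (length L)
shift-walk u v []ₗ m []ₗ u≡m v≡m[] _ = subst (λ z → Walk u z 0) u≡v stay
  where
  u≡v : u ≡ v
  u≡v = trans (sym (cast-is-id refl u))
          (toList-injective refl u v (trans u≡m (trans (sym (++-identityʳ m)) (sym v≡m[]))))
shift-walk (c ∷ u′) v (_ ∷ₗ pre) m (l ∷ₗ L) u≡ v≡ |pre|≡|L| =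
  step (l , refl) (shift-walk (u′ ∷ʳ l) v pre (m ++ [ l ]) L u′l≡ v≡′ (suc-injective |pre|≡|L|))
  where
  u′l≡ : toList (u′ ∷ʳ l) ≡ pre ++ (m ++ [ l ])
  u′l≡ = trans (toList-∷ʳ l u′) (trans (cong (_++ [ l ]) (∷-injectiveʳ u≡)) (++-assoc pre m [ l ]))
  v≡′ : toList v ≡ (m ++ [ l ]) ++ L
  v≡′ = trans v≡ (sym (++-assoc m [ l ] L))

overlap-length : ∀ {A : Set} (pre m L : List A) →
                 length (pre ++ m) ≡ length (m ++ L) → length pre ≡ length L
overlap-length pre m L same = +-cancelˡ-≡ (length m) (length pre) (length L) (begin
  length m + length pre ≡⟨ +-comm (length m) (length pre) ⟩
  length pre + length m ≡⟨ sym (length-++ pre) ⟩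
  length (pre ++ m)     ≡⟨ same ⟩
  length (m ++ L)       ≡⟨ length-++ m ⟩
  length m + length L   ∎)

overlap-in-ball : ∀ {d n t} {u v : Vertex d (suc n)} (pre m L : List (Fin d)) →
                  toList u ≡ pre ++ m → toList v ≡ m ++ L → length L ≤ t → InBall t v u
overlap-in-ball {u = u} {v} pre m L u≡ v≡ |L|≤t =
  length L , |L|≤t , shift-walk u v pre m L u≡ v≡ (overlap-length pre m L same-length)
  where
  same-length : length (pre ++ m) ≡ length (m ++ L)
  same-length = trans (cong length (sym u≡))
                  (trans (length-toList u) (trans (sym (length-toList v)) (cong length v≡)))

replicate-++ : ∀ {A : Set} (x : A) k l → replicate k x ++ replicate l x ≡ replicate (k + l) x
replicate-++ x zero l = refl
replicate-++ x (suc k) l = cong (x ∷ₗ_) (replicate-++ x k l)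

replicate-snoc : ∀ {A : Set} (x : A) k → replicate k x ++ [ x ] ≡ replicate (suc k) x
replicate-snoc x zero = refl
replicate-snoc x (suc k) = cong (x ∷ₗ_) (replicate-snoc x k)

length-replicate-++ : ∀ {A : Set} (x : A) k (ys : List A) → length (replicate k x ++ ys) ≡ k + length ys
length-replicate-++ x zero ys = refl
length-replicate-++ x (suc k) ys = cong suc (length-replicate-++ x k ys)

-- Every n with n + 2 ≤ 2s splits as n = a + (e + a) with e + a < s
-- (take a = ⌊n/2⌋ and e the parity of n).
balanced-split : ∀ n s → suc (suc n) ≤ 2 * s → ∃₂ λ a e → n ≡ a + (e + a) × suc (e + a) ≤ s
balanced-split zero (suc s) _ = 0 , 0 , refl , s≤s z≤n
balanced-split (suc zero) (suc (suc s)) _ = 0 , 1 , refl , s≤s (s≤s z≤n)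
balanced-split (suc zero) (suc zero) (s≤s (s≤s ()))
balanced-split (suc (suc n)) (suc s) bound
  with a , e , n≡ , e+a<s ← balanced-split n s (s≤s⁻¹ (subst (suc (suc (suc n)) ≤_) (+-suc s (s + 0)) (s≤s⁻¹ bound))) =
  suc a , e , cong suc n+2≡ , s≤s (subst (_≤ s) (sym (+-suc e a)) e+a<s)
  where
  n+2≡ : suc n ≡ a + (e + suc a)
  n+2≡ = begin
    suc n               ≡⟨ cong suc n≡ ⟩
    suc (a + (e + a))   ≡⟨ sym (+-suc a (e + a)) ⟩
    a + suc (e + a)     ≡⟨ cong (a +_) (sym (+-suc e a)) ⟩
    a + (e + suc a)     ∎

vector-of : ∀ {A : Set} {n} (xs : List A) → length xs ≡ n → Σ (Vec A n) λ p → toList p ≡ xs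
vector-of xs refl = fromList xs , toList∘fromList xs

-- The twins x = 0^a 1 0^(e+a) 0 and y = 0^a 1 0^(e+a) 1 and their overlaps.
module TwinWords {d : ℕ} (a e : ℕ) where

  Z : ℕ → List (Fin (suc (suc d)))
  Z k = replicate k 0F

  P : List (Fin (suc (suc d)))
  P = Z a ++ 1F ∷ₗ Z (e + a)

  length-P : length P ≡ suc (a + (e + a))
  length-P = trans (length-replicate-++ 0F a _)
               (trans (cong (λ k → a + suc k) (length-replicate (e + a))) (+-suc a (e + a)))

  -- x = 0^a 1 0^(e+a+1), the form from which both overlaps of x are read off
  x-normal : P ++ [ 0F ] ≡ Z a ++ 1F ∷ₗ Z (suc (e + a))
  x-normal = trans (++-assoc (Z a) (1F ∷ₗ Z (e + a)) [ 0F ])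
                   (cong (λ z → Z a ++ 1F ∷ₗ z) (replicate-snoc 0F (e + a)))

  x-as-pre·m : P ++ [ 0F ] ≡ (Z a ++ 1F ∷ₗ Z (suc e)) ++ Z a
  x-as-pre·m = trans x-normal (trans
    (cong (λ z → Z a ++ 1F ∷ₗ 0F ∷ₗ z) (sym (replicate-++ 0F e a)))
    (sym (++-assoc (Z a) (1F ∷ₗ Z (suc e)) (Z a))))

  y-as-m·L : P ++ [ 1F ] ≡ Z a ++ (1F ∷ₗ Z (e + a) ++ [ 1F ])
  y-as-m·L = ++-assoc (Z a) (1F ∷ₗ Z (e + a)) [ 1F ]

  y-as-pre·m : P ++ [ 1F ] ≡ (Z a ++ 1F ∷ₗ Z e) ++ (Z a ++ [ 1F ])
  y-as-pre·m = begin
    P ++ [ 1F ]                               ≡⟨ y-as-m·L ⟩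
    Z a ++ 1F ∷ₗ (Z (e + a) ++ [ 1F ])        ≡⟨ cong (λ z → Z a ++ 1F ∷ₗ (z ++ [ 1F ])) (sym (replicate-++ 0F e a)) ⟩
    Z a ++ 1F ∷ₗ ((Z e ++ Z a) ++ [ 1F ])     ≡⟨ cong (λ z → Z a ++ 1F ∷ₗ z) (++-assoc (Z e) (Z a) [ 1F ]) ⟩
    Z a ++ 1F ∷ₗ (Z e ++ Z a ++ [ 1F ])       ≡⟨ sym (++-assoc (Z a) (1F ∷ₗ Z e) (Z a ++ [ 1F ])) ⟩
    (Z a ++ 1F ∷ₗ Z e) ++ (Z a ++ [ 1F ])     ∎

  x-as-m·L : P ++ [ 0F ] ≡ (Z a ++ [ 1F ]) ++ Z (suc (e + a))
  x-as-m·L = trans x-normal (sym (++-assoc (Z a) [ 1F ] (Z (suc (e + a)))))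

  length-x→y : length (1F ∷ₗ Z (e + a) ++ [ 1F ]) ≡ suc (suc (e + a))
  length-x→y = cong suc (trans (length-replicate-++ 0F (e + a) [ 1F ]) (+-comm (e + a) 1))

  twins-close : ∀ {n s} (p : Vec (Fin (suc (suc d))) n) → toList p ≡ P → suc (e + a) ≤ s →
                InBall (suc s) (p ∷ʳ 1F) (p ∷ʳ 0F) × InBall (suc s) (p ∷ʳ 0F) (p ∷ʳ 1F)
  twins-close {s = s} p p≡P e+a<s =
      overlap-in-ball (Z a ++ 1F ∷ₗ Z (suc e)) (Z a) (1F ∷ₗ Z (e + a) ++ [ 1F ]) (x-word x-as-pre·m) (y-word y-as-m·L)
        (subst (_≤ suc s) (sym length-x→y) (s≤s e+a<s))
    , overlap-in-ball (Z a ++ 1F ∷ₗ Z e) (Z a ++ [ 1F ]) (Z (suc (e + a))) (y-word y-as-pre·m) (x-word x-as-m·L)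
        (subst (_≤ suc s) (sym (length-replicate (suc (e + a)))) (≤-trans e+a<s (n≤1+n s)))
    where
    x-word : ∀ {w} → P ++ [ 0F ] ≡ w → toList (p ∷ʳ 0F) ≡ w
    x-word = trans (trans (toList-∷ʳ 0F p) (cong (_++ [ 0F ]) p≡P))
    y-word : ∀ {w} → P ++ [ 1F ] ≡ w → toList (p ∷ʳ 1F) ≡ w
    y-word = trans (trans (toList-∷ʳ 1F p) (cong (_++ [ 1F ]) p≡P))

-- For 1 ≤ N ≤ 2t - 2 with t = s + 1, i.e. N ≤ 2s, the de Bruijn graph
-- B(d, N) over at least two letters has twins p·0 and p·1 each within
-- distance t of the other.
close-twins : ∀ {d} s n → suc n ≤ 2 * s →
              Σ (Vec (Fin (suc (suc d))) n) λ p →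
                InBall (suc s) (p ∷ʳ 1F) (p ∷ʳ 0F) × InBall (suc s) (p ∷ʳ 0F) (p ∷ʳ 1F)
close-twins s zero _ =
  [] , overlap-in-ball [ 0F ] []ₗ [ 1F ] refl refl (s≤s z≤n)
     , overlap-in-ball [ 1F ] []ₗ [ 0F ] refl refl (s≤s z≤n)
close-twins {d} s (suc n) bound
  with a , e , n≡ , e+a<s ← balanced-split n s bound
  with p , p≡P ← vector-of (TwinWords.P {d} a e) (trans (TwinWords.length-P a e) (cong suc (sym n≡)))
  = p , TwinWords.twins-close a e p p≡P e+a<s

theorem3p13 : (d t n : ℕ) → 2 ≤ d → 1 ≤ t → suc n ≤ 2 * t ∸ 2 →
    (S : Vertex d (suc n) → Bool) → ¬ IsIdentifyingCode {d} {n} t S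
theorem3p13 (suc (suc d)) (suc s) n _ _ bound S
  with p , x∈By , y∈Bx ← close-twins s n (subst (suc n ≤_) (sym (*-distribˡ-∸ 2 (suc s) 1)) bound)
  = close-twins⇒no-code p (λ ()) x∈By y∈Bx S
theorem3p13 (suc (suc d)) zero n _ () _ S
theorem3p13 zero t n () _ _ S
theorem3p13 (suc zero) t n (s≤s ()) _ _ S
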